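{- Let $n\in\mathbb{Z}^+$ and consider, in the ring $\mathbb{Z}$, the Frobenius template $(\mathbb{N},(n+\mathbb{N})\cup\{0\},\mathbb{N})$, so that for $a,b\in\mathbb{N}$, $MN(a,b)=\{\lambda_1a+\lambda_2b:\lambda_1,\lambda_2\in(n+\mathbb{N})\cup\{0\}\}$ and $\mathrm{Frob}(a,b)=\{w\in\mathbb{Z}: w+\mathbb{N}\subseteq MN(a,b)\}$. Let $a,b\in\mathbb{N}$. If $a,b$ are coprime and $n-1$ is divisible by neither $a$ nor $b$, then \[\mathrm{Frob}(a,b)=(a+b)n+\chi(a,b)+\mathbb{N}.\]
   Context: $\mathbb{N}$ denotes the nonnegative integers, $\mathbb{Z}^+=\mathbb{N}\setminus\{0\}$, and $c+\mathbb{N}=\{c+m:m\in\mathbb{N}\}$. $a,b$ coprime means $\gcd(a,b)=1$. For coprime $a,b\in\mathbb{N}$, $\chi(a,b)$ is the least $w\in\mathbb{N}$ such that $w+\mathbb{N}\subseteq\{\lambda_1a+\lambda_2b:\lambda_1,\lambda_2\in\mathbb{N}\}$; classically $\chi(a,b)=(a-1)(b-1)$. -}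

module Defs where

open import Data.Nat using (ℕ; _+_; _*_; _≤_)
open import Data.Product using (Σ; ∃; _×_; _,_)
open import Data.Sum using (_⊎_)
open import Relation.Binary.PropositionalEquality using (_≡_)
import Data.Integer as ℤ
open ℤ using (ℤ; +_)

InSpan : ℕ → ℕ → ℕ → Set
InSpan a b x = Σ ℕ λ l₁ → Σ ℕ λ l₂ → x ≡ l₁ * a + l₂ * b

IsChi : ℕ → ℕ → ℕ → Set
IsChi a b w =
  ((m : ℕ) → InSpan a b (w + m)) ×
  ((v : ℕ) → ((m : ℕ) → InSpan a b (v + m)) → w ≤ v)

InM : ℕ → ℕ → Set
InM n l = (n ≤ l) ⊎ (l ≡ 0)

InMN : ℕ → ℕ → ℕ → ℤ → Set
InMN n a b z = Σ ℕ λ l₁ → Σ ℕ λ l₂ →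
  InM n l₁ × InM n l₂ × (z ≡ + (l₁ * a + l₂ * b))

InFrob : ℕ → ℕ → ℕ → ℤ → Set
InFrob n a b w = (m : ℕ) → InMN n a b (w ℤ.+ + m)

{-# OPTIONS --safe #-}
module Submission where

-- Adding n to both multipliers maps ⟨a, b⟩ = {λ₁ a + λ₂ b} onto the part of MN(a, b) with
-- nonzero multipliers shifted by (a + b) n, so (a + b) n + χ + ℕ ⊆ MN(a, b). The number
-- (a + b) n + χ − 1 is not in MN(a, b): with both multipliers ≥ n this would put the gap
-- χ − 1 into ⟨a, b⟩; with one multiplier zero it is, say, a multiple of b, and so is
-- χ − 1 + a ∈ ⟨a, b⟩ (its a-coefficient must vanish), whence b ∣ a (n − 1) and b ∣ n − 1.

open import Defs
open import Data.Nat using (ℕ; zero; suc; _+_; _*_; _∸_; _≤_; _≤?_; NonZero)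
open import Data.Nat.Properties
open import Data.Nat.Divisibility using (_∣_; divides; 1∣_; ∣m+n∣m⇒∣n; ∣m∣n⇒∣m+n)
open import Data.Nat.Coprimality using (Coprime; coprime-divisor; 0-coprimeTo-m⇒m≡1)
import Data.Nat.Coprimality as Coprime
open import Data.Nat.Solver using (module +-*-Solver)
open import Data.Product using (_,_; proj₁)
open import Data.Sum using (_⊎_; inj₁; inj₂; [_,_])
open import Data.Empty using (⊥; ⊥-elim)
open import Relation.Nullary using (¬_; yes; no)
open import Relation.Binary.PropositionalEquality hiding ([_])
open import Function.Bundles using (_⇔_; mk⇔)
import Data.Integer as ℤ
import Data.Integer.Properties as ℤP
open ℤ using (ℤ; +_; -[1+_])

open +-*-Solver

∤⇒≢1 : ∀ {a k} → ¬ (a ∣ k) → a ≢ 1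
∤⇒≢1 a∤k refl = a∤k (1∣ _)

InSpan-comm : ∀ {a b x} → InSpan a b x → InSpan b a x
InSpan-comm {a} {b} (l₁ , l₂ , x≡) = l₂ , l₁ , trans x≡ (+-comm (l₁ * a) (l₂ * b))

IsChi-comm : ∀ {a b c} → IsChi a b c → IsChi b a c
IsChi-comm (above , least) = (λ m → InSpan-comm (above m)) , λ v h → least v (λ m → InSpan-comm (h m))

IsChi⇒gap : ∀ {a b d} → IsChi a b (suc d) → ¬ InSpan a b d
IsChi⇒gap {a} {b} {d} (above , least) d∈ = 1+n≰n (least d from-d)
  where
  from-d : ∀ m → InSpan a b (d + m)
  from-d zero    = subst (InSpan a b) (sym (+-identityʳ d)) d∈
  from-d (suc m) = subst (InSpan a b) (sym (+-suc d m)) (above m)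

1∈span⇒≡1 : ∀ {a b} → InSpan a b 1 → a ≡ 1 ⊎ b ≡ 1
1∈span⇒≡1 {a} {b} (l₁ , l₂ , 1≡) with l₁ * a in eq
... | zero        = inj₂ (m*n≡1⇒n≡1 l₂ b (sym 1≡))
... | suc zero    = inj₁ (m*n≡1⇒n≡1 l₁ a eq)
... | suc (suc _) with () ← 1≡

gap⇒∣gap+a : ∀ {a b d} → ¬ InSpan a b d → InSpan a b (d + a) → b ∣ d + a
gap⇒∣gap+a         gap (zero   , l₂ , d+a≡) = divides l₂ d+a≡
gap⇒∣gap+a {a} {b} {d} gap (suc l₁ , l₂ , d+a≡) = ⊥-elim (gap (l₁ , l₂ , d≡))
  where
  d≡ : d ≡ l₁ * a + l₂ * b
  d≡ = +-cancelʳ-≡ a d (l₁ * a + l₂ * b) (trans d+a≡ (solve 4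
         (λ l₁ l₂ a b → (a :+ l₁ :* a) :+ l₂ :* b := (l₁ :* a :+ l₂ :* b) :+ a) refl l₁ l₂ a b))

-- d + a lies in the span but d does not, so b ∣ d + a; then b ∣ a k, hence b ∣ k.
gap-not-multiple : ∀ {a b k d} → Coprime a b → ¬ (b ∣ k) → IsChi a b (suc d) →
  ¬ (b ∣ (a + b) * suc k + d)
gap-not-multiple {zero} cop b∤k _ _ = ∤⇒≢1 b∤k (0-coprimeTo-m⇒m≡1 cop)
gap-not-multiple {suc a′} {b} {k} {d} cop b∤k chi b∣ =
  b∤k (coprime-divisor (Coprime.sym cop) (∣m+n∣m⇒∣n (subst (b ∣_) split b∣) b∣rest))
  where
  a = suc a′
  b∣d+a : b ∣ d + a
  b∣d+a = gap⇒∣gap+a (IsChi⇒gap chi) (subst (InSpan a b) (sym (+-suc d a′)) (proj₁ chi a′))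
  b∣rest : b ∣ (suc k * b) + (d + a)
  b∣rest = ∣m∣n⇒∣m+n (divides (suc k) refl) b∣d+a
  split : (a + b) * suc k + d ≡ (suc k * b + (d + a)) + a * k
  split = solve 4 (λ a b k d → (a :+ b) :* (con 1 :+ k) :+ d := ((con 1 :+ k) :* b :+ (d :+ a)) :+ a :* k)
            refl a b k d

InSpan⇒InMN : ∀ n {a b x} → InSpan a b x → InMN n a b (+ ((a + b) * n + x))
InSpan⇒InMN n {a} {b} {x} (l₁ , l₂ , x≡) =
  n + l₁ , n + l₂ , inj₁ (m≤m+n n l₁) , inj₁ (m≤m+n n l₂) , cong +_ (begin
    (a + b) * n + x                 ≡⟨ cong (λ y → (a + b) * n + y) x≡ ⟩
    (a + b) * n + (l₁ * a + l₂ * b) ≡⟨ solve 5 (λ n a b l₁ l₂ →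
                                         (a :+ b) :* n :+ (l₁ :* a :+ l₂ :* b) := (n :+ l₁) :* a :+ (n :+ l₂) :* b)
                                         refl n a b l₁ l₂ ⟩
    (n + l₁) * a + (n + l₂) * b     ∎)
  where open ≡-Reasoning

InMN⇒InSpan : ∀ {n a b x l₁ l₂} → n ≤ l₁ → n ≤ l₂ →
  (a + b) * n + x ≡ l₁ * a + l₂ * b → InSpan a b x
InMN⇒InSpan {n} {a} {b} {x} {l₁} {l₂} n≤l₁ n≤l₂ eq =
  l₁ ∸ n , l₂ ∸ n , +-cancelˡ-≡ ((a + b) * n) x _ (begin
    (a + b) * n + x                                     ≡⟨ eq ⟩
    l₁ * a + l₂ * b                                     ≡⟨ cong₂ (λ u v → u * a + v * b) (sym (m+[n∸m]≡n n≤l₁)) (sym (m+[n∸m]≡n n≤l₂)) ⟩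
    (n + (l₁ ∸ n)) * a + (n + (l₂ ∸ n)) * b             ≡⟨ solve 5 (λ n a b p q →
                                                             (n :+ p) :* a :+ (n :+ q) :* b := (a :+ b) :* n :+ (p :* a :+ q :* b))
                                                             refl n a b (l₁ ∸ n) (l₂ ∸ n) ⟩
    (a + b) * n + ((l₁ ∸ n) * a + (l₂ ∸ n) * b)         ∎)
  where open ≡-Reasoning

frobenius-gap : ∀ {a b k d} → Coprime a b → ¬ (a ∣ k) → ¬ (b ∣ k) → IsChi a b (suc d) →
  ¬ InMN (suc k) a b (+ ((a + b) * suc k + d))
frobenius-gap {a} {b} {k} {d} cop a∤k b∤k chi (l₁ , l₂ , m₁ , m₂ , eq) = case m₁ m₂
  where
  eqℕ : (a + b) * suc k + d ≡ l₁ * a + l₂ * b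
  eqℕ = ℤP.+-injective eq
  case : InM (suc k) l₁ → InM (suc k) l₂ → ⊥
  case (inj₂ refl) _ = gap-not-multiple cop b∤k chi (divides l₂ eqℕ)
  case _ (inj₂ refl) = gap-not-multiple (Coprime.sym cop) a∤k (IsChi-comm chi)
    (divides l₁ (trans (cong (λ s → s * suc k + d) (+-comm b a)) (trans eqℕ (+-identityʳ (l₁ * a)))))
  case (inj₁ n≤l₁) (inj₁ n≤l₂) = IsChi⇒gap chi (InMN⇒InSpan n≤l₁ n≤l₂ eqℕ)

upward-closure-threshold : (S : ℤ → Set) (X : ℕ) {K : ℕ} → suc X ≡ K →
  ¬ S (+ X) → (∀ t → S (+ (K + t))) →
  (w : ℤ) → (∀ m → S (w ℤ.+ + m)) ⇔ (+ K ℤ.≤ w)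
upward-closure-threshold S X refl X∉S K+ℕ⊆S w = mk⇔ (≥K w) shift⊆S
  where
  ≥K : ∀ w → (∀ m → S (w ℤ.+ + m)) → + suc X ℤ.≤ w
  ≥K -[1+ k ] w+ℕ⊆S = ⊥-elim (X∉S (subst S reach-X (w+ℕ⊆S (suc k + X))))
    where
    reach-X : -[1+ k ] ℤ.+ + (suc k + X) ≡ + X
    reach-X = trans (ℤP.⊖-≥ (m≤m+n (suc k) X)) (cong +_ (m+n∸m≡n (suc k) X))
  ≥K (+ k) w+ℕ⊆S with suc X ≤? k
  ... | yes X<k = ℤ.+≤+ X<k
  ... | no  X≮k = ⊥-elim (X∉S (subst S (cong +_ (m+[n∸m]≡n (≮⇒≥ X≮k))) (w+ℕ⊆S (X ∸ k))))
  shift⊆S : + suc X ℤ.≤ w → ∀ m → S (w ℤ.+ + m)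
  shift⊆S (ℤ.+≤+ {n = k} K≤k) m = subst S (cong +_ (begin
      suc X + (k ∸ suc X + m)   ≡⟨ sym (+-assoc (suc X) (k ∸ suc X) m) ⟩
      suc X + (k ∸ suc X) + m   ≡⟨ cong (_+ m) (m+[n∸m]≡n K≤k) ⟩
      k + m                     ∎)) (K+ℕ⊆S (k ∸ suc X + m))
    where open ≡-Reasoning

proposition3p2 : (n : ℕ) → .{{_ : NonZero n}} → (a b : ℕ) → Coprime a b →
    ¬ (a ∣ n ∸ 1) → ¬ (b ∣ n ∸ 1) → (c : ℕ) → IsChi a b c →
    (w : ℤ.ℤ) → InFrob n a b w ⇔ (ℤ.+ ((a + b) * n + c) ℤ.≤ w)
proposition3p2 (suc k) a b _ a∤k b∤k zero chi =
  ⊥-elim ([ ∤⇒≢1 a∤k , ∤⇒≢1 b∤k ] (1∈span⇒≡1 (proj₁ chi 1)))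
proposition3p2 (suc k) a b cop a∤k b∤k (suc d) chi =
  upward-closure-threshold (InMN (suc k) a b) ((a + b) * suc k + d) (sym (+-suc _ d))
    (frobenius-gap cop a∤k b∤k chi)
    (λ t → subst (λ x → InMN (suc k) a b (+ x)) (sym (+-assoc _ (suc d) t))
             (InSpan⇒InMN (suc k) (proj₁ chi t)))
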